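{- Let $\mathscr{S}$ be the set of integer partitions $\mu_1+\cdots+\mu_s$ (empty partition included) with $\mu_i-\mu_{i+1}\ge 3$ for all $i$ and strict inequality whenever $3\mid\mu_i$, and define $a(M)$ by $$\sum_{M\ge0}a(M)x^M=\sum_{\lambda\in\mathscr{S}}x^{\sharp(\lambda)}y^{\sharp_{0,2}(\lambda)}q^{|\lambda|}.$$ Then for any $M\ge 0$, \begin{align*} 0 &= q^{12M}(y^2q^{31} + y^3q^{32})a(M)\\ &\quad +q^{12(M+1)}(-q^{22}- yq^{23}+ y^2q^{30}- y^3q^{25}- y^4q^{26})a(M+1)\\ &\quad+ \big[{ -q^{6(M+2)}}(yq^{12} + yq^{14} + y^2q^{13} + y^2q^{15})+q^{12(M+2)}(-q^{21}+ yq^{16}+ y^2q^{17}- y^3q^{24})\big]a(M+2)\\ &\quad +\big[{ -q^{6(M+3)}}(q^6 + q^8 + q^{10} + yq^5 + 2 yq^7 + 2 yq^9 + 2 yq^{11} + yq^{13} + y^2q^8 + y^2q^{10} + y^2q^{12}) +q^{12(M+3)}yq^{15}\big]a(M+3)\\ &\quad+\big[(q^7+ yq^8)-q^{6(M+4)}(q + q^3 + q^5 + q^7 + yq^2 + yq^4 + yq^6 + yq^8)\big]a(M+4)\\ &\quad+\big[1-q^{6(M+5)}\big]a(M+5). \end{align*}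
   Context: For a partition $\lambda$, $|\lambda|$ is the sum of its parts, $\sharp(\lambda)$ the number of parts, and $\sharp_{0,2}(\lambda)$ the number of even parts. -}

module Defs where

open import Data.Nat using (ℕ; zero; suc; _+_; _*_; _∸_; _≤ᵇ_; _≡ᵇ_; _%_)
open import Data.Bool using (Bool; true; false; _∧_; if_then_else_)
open import Data.List using (List; []; _∷_; map; _++_; length; filter; foldr)
open import Data.Integer using (ℤ; +_; -[1+_]) renaming (_+_ to _+ℤ_; _*_ to _*ℤ_)
open import Data.Product using (_×_; _,_)

-- Partitions are lists of positive parts  μ₁ ∷ μ₂ ∷ … ∷ μₛ ∷ []
-- (largest part first).

-- All compositions (ordered lists of positive parts) of n.
-- Compositions of n+2 are obtained from those of n+1 either by
-- increasing the first part or by prepending a new part 1.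
incHead : List ℕ → List ℕ
incHead []       = []
incHead (x ∷ xs) = suc x ∷ xs

comps : ℕ → List (List ℕ)
comps zero          = [] ∷ []
comps (suc zero)    = (1 ∷ []) ∷ []
comps (suc (suc n)) = map incHead (comps (suc n)) ++ map (1 ∷_) (comps (suc n))

div3 : ℕ → Bool
div3 x = (x % 3) ≡ᵇ 0

gapOK : ℕ → ℕ → Bool
gapOK x y = if div3 x then (y + 4) ≤ᵇ x else (y + 3) ≤ᵇ x

inS : List ℕ → Bool
inS []           = true
inS (x ∷ [])     = true
inS (x ∷ y ∷ ys) = gapOK x y ∧ inS (y ∷ ys)

-- ♯_{0,2}(λ): number of even parts
even? : ℕ → Bool
even? x = (x % 2) ≡ᵇ 0

numEven : List ℕ → ℕ
numEven []       = 0
numEven (x ∷ xs) = if even? x then suc (numEven xs) else numEven xs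

countB : {A : Set} → (A → Bool) → List A → ℕ
countB p []       = 0
countB p (x ∷ xs) = if p x then suc (countB p xs) else countB p xs

-- Formal power series in q with coefficients in ℤ[y], represented by
-- their coefficient function: s n k = coefficient of qⁿ yᵏ.

Series : Set
Series = ℕ → ℕ → ℤ

-- a(M): coefficient of qⁿ yᵏ is the number of λ ∈ 𝒮 with ♯(λ) = M,
-- ♯_{0,2}(λ) = k, |λ| = n.
a : ℕ → Series
a M n k = + countB (λ μ → inS μ ∧ (length μ ≡ᵇ M) ∧ (numEven μ ≡ᵇ k)) (comps n)

-- A monomial  c · q^i · y^j  is represented by (c , i , j).
Mono : Set
Mono = ℤ × ℕ × ℕ

monoTimes : Mono → Series → Series
monoTimes (c , i , j) s n k =
  if (i ≤ᵇ n) ∧ (j ≤ᵇ k) then c *ℤ s (n ∸ i) (k ∸ j) else + 0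

polyTimes : List Mono → Series → Series
polyTimes P s n k = foldr (λ m acc → monoTimes m s n k +ℤ acc) (+ 0) P

m1 m2 p1 : ℤ
m1 = -[1+ 0 ]
m2 = -[1+ 1 ]
p1 = + 1

P0 : ℕ → List Mono
P0 M = (p1 , 12 * M + 31 , 2) ∷ (p1 , 12 * M + 32 , 3) ∷ []

P1 : ℕ → List Mono
P1 M = let e = 12 * (M + 1) in
  (m1 , e + 22 , 0) ∷ (m1 , e + 23 , 1) ∷ (p1 , e + 30 , 2) ∷
  (m1 , e + 25 , 3) ∷ (m1 , e + 26 , 4) ∷ []

P2 : ℕ → List Mono
P2 M = let f = 6 * (M + 2) ; e = 12 * (M + 2) in
  (m1 , f + 12 , 1) ∷ (m1 , f + 14 , 1) ∷ (m1 , f + 13 , 2) ∷ (m1 , f + 15 , 2) ∷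
  (m1 , e + 21 , 0) ∷ (p1 , e + 16 , 1) ∷ (p1 , e + 17 , 2) ∷ (m1 , e + 24 , 3) ∷ []

P3 : ℕ → List Mono
P3 M = let f = 6 * (M + 3) ; e = 12 * (M + 3) in
  (m1 , f + 6 , 0) ∷ (m1 , f + 8 , 0) ∷ (m1 , f + 10 , 0) ∷
  (m1 , f + 5 , 1) ∷ (m2 , f + 7 , 1) ∷ (m2 , f + 9 , 1) ∷ (m2 , f + 11 , 1) ∷ (m1 , f + 13 , 1) ∷
  (m1 , f + 8 , 2) ∷ (m1 , f + 10 , 2) ∷ (m1 , f + 12 , 2) ∷
  (p1 , e + 15 , 1) ∷ []

P4 : ℕ → List Mono
P4 M = let f = 6 * (M + 4) in
  (p1 , 7 , 0) ∷ (p1 , 8 , 1) ∷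
  (m1 , f + 1 , 0) ∷ (m1 , f + 3 , 0) ∷ (m1 , f + 5 , 0) ∷ (m1 , f + 7 , 0) ∷
  (m1 , f + 2 , 1) ∷ (m1 , f + 4 , 1) ∷ (m1 , f + 6 , 1) ∷ (m1 , f + 8 , 1) ∷ []

P5 : ℕ → List Mono
P5 M = (p1 , 0 , 0) ∷ (m1 , 6 * (M + 5) , 0) ∷ []

recurrenceRHS : ℕ → Series
recurrenceRHS M n k =
  polyTimes (P0 M) (a M) n k +ℤ
  polyTimes (P1 M) (a (M + 1)) n k +ℤ
  polyTimes (P2 M) (a (M + 2)) n k +ℤ
  polyTimes (P3 M) (a (M + 3)) n k +ℤ
  polyTimes (P4 M) (a (M + 4)) n k +ℤ
  polyTimes (P5 M) (a (M + 5)) n k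

-- Let F r count the partitions in 𝒮 with all parts ≥ r, by number of parts M,
-- weight n and number k of even parts, so that a(M) is read off F 1.  Splitting
-- off a smallest part r gives
--   F r (M, n, k) = F (r + 1) (M, n, k) + F (r + gap r) (M − 1, n − r, k − [r even]),
-- where gap r ∈ {3, 4} is the least difference allowed above r; and since the
-- gap rule and the parity of a part only depend on it modulo 6, subtracting 6
-- from every part gives F (r + 6) (M, n, k) = F r (M, n − 6M, k).  The equations
-- for r = 1, …, 6 therefore form a closed system in F 1, …, F 6 at shifted
-- arguments, and eliminating F 2, …, F 6 produces the recurrence.  The elimination
-- is recorded as an explicit integer combination of instances of these equations
-- whose sum with the recurrence cancels term by term.

module Submission where

open import Defs
open import Data.Bool using (Bool; true; false; _∧_; if_then_else_; T)
open import Data.Bool.Properties using (if-eta; if-float; T-≡; ∧-assoc; ∧-zeroʳ)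
open import Data.Integer using (ℤ; +_; -[1+_]; 0ℤ; 1ℤ; -1ℤ; ∣_∣; _+_; _-_; _*_; -_; _<_; -<+; +<+)
import Data.Integer.Properties as ℤₚ
open import Data.Integer.Tactic.RingSolver using (solve-∀)
open import Algebra.Properties.CommutativeSemigroup ℤₚ.+-commutativeSemigroup using (interchange; xy∙z≈xz∙y; x∙yz≈y∙xz)
open import Data.Nat as ℕ using (ℕ; zero; suc; _≤ᵇ_; _≡ᵇ_; _∸_; z≤n; s≤s)
import Data.Nat.Properties as ℕₚ
open import Data.Nat.DivMod using ([m+kn]%n≡m%n)
open import Data.Nat.ListAction using (sum)
open import Data.List using (List; []; _∷_; map; _++_; length; foldr; concat; concatMap)
open import Data.List.Relation.Unary.All as All using (All; []; _∷_)
open import Data.List.Relation.Unary.All.Properties using (map⁺; ++⁺)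
open import Data.Nat.Induction using (<-rec)
open import Data.Product using (_,_; _×_; proj₁; proj₂; map₁; map₂)
open import Data.Product.Properties using (≡-dec)
open import Data.Sum using (inj₁; inj₂)
open import Function using (_∘_; Equivalence)
open import Relation.Binary.PropositionalEquality
open import Relation.Nullary using (¬_; Dec; contradiction; yes; no)
open import Relation.Nullary.Decidable using (toWitness)
open import Relation.Binary.Definitions using (tri<; tri≈; tri>; DecidableEquality)

≤ᵇ-true : ∀ {m n} → m ℕ.≤ n → (m ≤ᵇ n) ≡ true
≤ᵇ-true = Equivalence.to T-≡ ∘ ℕₚ.≤⇒≤ᵇ

≤ᵇ-false : ∀ {m n} → n ℕ.< m → (m ≤ᵇ n) ≡ false
≤ᵇ-false {m} {n} n<m with m ≤ᵇ n in eq
... | false = refl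
... | true  = contradiction (ℕₚ.≤ᵇ⇒≤ m n (subst T (sym eq) _)) (ℕₚ.<⇒≱ n<m)

if-then-0 : ∀ b {x : ℤ} → x ≡ 0ℤ → (if b then x else 0ℤ) ≡ 0ℤ
if-then-0 b refl = if-eta b

if-≤ : ∀ {m n} {x y : ℤ} → m ℕ.≤ n → (if m ≤ᵇ n then x else y) ≡ x
if-≤ m≤n rewrite ≤ᵇ-true m≤n = refl

if-> : ∀ {m n} {x y : ℤ} → n ℕ.< m → (if m ≤ᵇ n then x else y) ≡ y
if-> n<m rewrite ≤ᵇ-false n<m = refl

i<0⇒i-n<0 : ∀ {i} h → i < 0ℤ → i - + h < 0ℤ
i<0⇒i-n<0 {i} h i<0 = ℤₚ.≤-<-trans (ℤₚ.i-j≤i i (+ h)) i<0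

+m-+n≡+[m∸n] : ∀ {m n} → n ℕ.≤ m → + m - + n ≡ + (m ∸ n)
+m-+n≡+[m∸n] {m} {n} n≤m = trans (ℤₚ.m-n≡m⊖n m n) (ℤₚ.⊖-≥ n≤m)

m<n⇒+m-+n<0 : ∀ {m n} → m ℕ.< n → + m - + n < 0ℤ
m<n⇒+m-+n<0 {m} {n} m<n = subst (+ m - + n <_) (ℤₚ.+-inverseʳ (+ n)) (ℤₚ.+-monoˡ-< (- + n) (+<+ m<n))

-- Gaps between parts

gap : ℕ → ℕ
gap h = if div3 h then 4 else 3

evenBit : ℕ → ℕ
evenBit h = if even? h then 1 else 0

gap≥3 : ∀ h → 3 ℕ.≤ gap h
gap≥3 h with div3 h
... | true  = s≤s (s≤s (s≤s z≤n))
... | false = ℕₚ.≤-refl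

gap≤4 : ∀ h → gap h ℕ.≤ 4
gap≤4 h with div3 h
... | true  = ℕₚ.≤-refl
... | false = ℕₚ.n≤1+n 3

gap-+3 : ∀ h → gap (h ℕ.+ 3) ≡ gap h
gap-+3 h = cong (λ x → if x ≡ᵇ 0 then 4 else 3) ([m+kn]%n≡m%n h 1 3)

≤ᵇ-∸ : ∀ {r x} g → 0 ℕ.< r → (r ≤ᵇ x ∸ g) ≡ (r ℕ.+ g ≤ᵇ x)
≤ᵇ-∸ {r} {x} g r>0 with r ℕ.+ g ℕ.≤? x
... | yes r+g≤x = trans (≤ᵇ-true (ℕₚ.m+n≤o⇒m≤o∸n r r+g≤x)) (sym (≤ᵇ-true r+g≤x))
... | no  r+g≰x = trans (≤ᵇ-false (ℕₚ.≰⇒> r≰x∸g)) (sym (≤ᵇ-false (ℕₚ.≰⇒> r+g≰x)))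
  where
  r≰x∸g : ¬ r ℕ.≤ x ∸ g
  r≰x∸g r≤x∸g with ℕₚ.≤-total g x
  ... | inj₁ g≤x = r+g≰x (ℕₚ.m≤o∸n⇒m+n≤o r g≤x r≤x∸g)
  ... | inj₂ x≤g = ℕₚ.<⇒≱ r>0 (subst (r ℕ.≤_) (ℕₚ.m≤n⇒m∸n≡0 x≤g) r≤x∸g)

-- Whether r may follow x in a partition of 𝒮 is decided by gap x, but it can be
-- read off gap r as well: the two differ only when x = r + 3, and gap has period 3.
≤ᵇ-gap-sym : ∀ {r} x → 0 ℕ.< r → (r ≤ᵇ x ∸ gap x) ≡ (r ℕ.+ gap r ≤ᵇ x)
≤ᵇ-gap-sym {r} x r>0 with ℕₚ.<-cmp x (r ℕ.+ 3)
... | tri< x<r+3 _ _ = trans (≤ᵇ-∸ (gap x) r>0) (trans (≤ᵇ-false (room x)) (sym (≤ᵇ-false (room r))))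
  where
  room : ∀ y → x ℕ.< r ℕ.+ gap y
  room y = ℕₚ.<-≤-trans x<r+3 (ℕₚ.+-monoʳ-≤ r (gap≥3 y))
... | tri≈ _ refl _ = trans (≤ᵇ-∸ (gap x) r>0) (cong (λ g → r ℕ.+ g ≤ᵇ x) (gap-+3 r))
... | tri> _ _ r+3<x = trans (≤ᵇ-∸ (gap x) r>0) (trans (≤ᵇ-true (fits x)) (sym (≤ᵇ-true (fits r))))
  where
  fits : ∀ y → r ℕ.+ gap y ℕ.≤ x
  fits y = ℕₚ.≤-trans (ℕₚ.+-monoʳ-≤ r (gap≤4 y)) (subst (λ z → z ℕ.≤ x) (sym (ℕₚ.+-suc r 3)) r+3<x)

gap-+6 : ∀ h → gap (h ℕ.+ 6) ≡ gap h
gap-+6 h = cong (λ x → if x ≡ᵇ 0 then 4 else 3) ([m+kn]%n≡m%n h 2 3)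

evenBit-+6 : ∀ h → evenBit (h ℕ.+ 6) ≡ evenBit h
evenBit-+6 h = cong (λ x → if x ≡ᵇ 0 then 1 else 0) ([m+kn]%n≡m%n h 3 2)

-- Finite sums and counts

sumTo : ℕ → (ℕ → ℤ) → ℤ
sumTo zero    f = 0ℤ
sumTo (suc b) f = sumTo b f + f (suc b)

sumTo-cong : ∀ b {f g : ℕ → ℤ} → (∀ {h} → 0 ℕ.< h → h ℕ.≤ b → f h ≡ g h) → sumTo b f ≡ sumTo b g
sumTo-cong zero    f≗g = refl
sumTo-cong (suc b) f≗g = cong₂ _+_ (sumTo-cong b λ h>0 h≤b → f≗g h>0 (ℕₚ.m≤n⇒m≤1+n h≤b)) (f≗g (s≤s z≤n) ℕₚ.≤-refl)

sumTo-zero : ∀ b {f : ℕ → ℤ} → (∀ {h} → 0 ℕ.< h → h ℕ.≤ b → f h ≡ 0ℤ) → sumTo b f ≡ 0ℤ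
sumTo-zero zero    f≗0 = refl
sumTo-zero (suc b) f≗0 = cong₂ _+_ (sumTo-zero b λ h>0 h≤b → f≗0 h>0 (ℕₚ.m≤n⇒m≤1+n h≤b)) (f≗0 (s≤s z≤n) ℕₚ.≤-refl)

sumTo-+ : ∀ b c (f : ℕ → ℤ) → sumTo (b ℕ.+ c) f ≡ sumTo c f + sumTo b (λ h → f (h ℕ.+ c))
sumTo-+ zero    c f = sym (ℤₚ.+-identityʳ _)
sumTo-+ (suc b) c f = trans (cong (_+ f (suc b ℕ.+ c)) (sumTo-+ b c f)) (ℤₚ.+-assoc (sumTo c f) _ _)

sumTo-suc : ∀ b (f : ℕ → ℤ) → sumTo (suc b) f ≡ f 1 + sumTo b (f ∘ suc)
sumTo-suc zero    f = ℤₚ.+-comm 0ℤ (f 1)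
sumTo-suc (suc b) f = trans (cong (_+ f (suc (suc b))) (sumTo-suc b f)) (ℤₚ.+-assoc (f 1) _ _)

sumTo-tail : ∀ {c b} (f : ℕ → ℤ) → c ℕ.≤ b → (∀ {h} → c ℕ.< h → h ℕ.≤ b → f h ≡ 0ℤ) → sumTo b f ≡ sumTo c f
sumTo-tail {c} {b} f c≤b tail≗0 = begin
  sumTo b f                                     ≡⟨ cong (λ x → sumTo x f) (sym t+c≡b) ⟩
  sumTo (t ℕ.+ c) f                             ≡⟨ sumTo-+ t c f ⟩
  sumTo c f + sumTo t (λ h → f (h ℕ.+ c))       ≡⟨ cong (λ x → sumTo c f + x) (sumTo-zero t λ h>0 h≤t → tail≗0 (c<h+c h>0) (h+c≤b h≤t)) ⟩
  sumTo c f + 0ℤ                                ≡⟨ ℤₚ.+-identityʳ _ ⟩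
  sumTo c f                                     ∎
  where
  open ≡-Reasoning
  t = b ∸ c
  t+c≡b : t ℕ.+ c ≡ b
  t+c≡b = ℕₚ.m∸n+n≡m c≤b
  c<h+c : ∀ {h} → 0 ℕ.< h → c ℕ.< h ℕ.+ c
  c<h+c {h} h>0 = subst (c ℕ.<_) (ℕₚ.+-comm c h) (ℕₚ.m<m+n c h>0)
  h+c≤b : ∀ {h} → h ℕ.≤ t → h ℕ.+ c ℕ.≤ b
  h+c≤b h≤t = subst (_ ℕ.≤_) t+c≡b (ℕₚ.+-monoˡ-≤ c h≤t)

sumTo-truncate : ∀ b c (f : ℕ → ℤ) → (∀ {h} → c ℕ.< h → f h ≡ 0ℤ) →
                 sumTo b f ≡ sumTo c (λ h → if h ≤ᵇ b then f h else 0ℤ)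
sumTo-truncate b c f f≗0 with ℕₚ.≤-total b c
... | inj₁ b≤c = sym (trans (sumTo-tail _ b≤c (λ b<h _ → if-> b<h)) (sumTo-cong b (λ _ h≤b → if-≤ h≤b)))
... | inj₂ c≤b = trans (sumTo-tail f c≤b (λ c<h _ → f≗0 c<h)) (sumTo-cong c (λ _ h≤c → sym (if-≤ (ℕₚ.≤-trans h≤c c≤b))))

countB-++ : ∀ {A : Set} (p : A → Bool) xs ys → countB p (xs ++ ys) ≡ countB p xs ℕ.+ countB p ys
countB-++ p []       ys = refl
countB-++ p (x ∷ xs) ys with p x
... | true  = cong suc (countB-++ p xs ys)
... | false = countB-++ p xs ys

countB-map : ∀ {A B : Set} (p : B → Bool) (f : A → B) xs → countB p (map f xs) ≡ countB (p ∘ f) xs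
countB-map p f []       = refl
countB-map p f (x ∷ xs) with p (f x)
... | true  = cong suc (countB-map p f xs)
... | false = countB-map p f xs

countB-cong : ∀ {A : Set} {P : A → Set} {p q : A → Bool} {xs} → (∀ {x} → P x → p x ≡ q x) → All P xs → countB p xs ≡ countB q xs
countB-cong             p≗q []                = refl
countB-cong {q = q} {x ∷ _} p≗q (px ∷ pxs) rewrite p≗q px with q x
... | true  = cong suc (countB-cong p≗q pxs)
... | false = countB-cong p≗q pxs

countB-∧ : ∀ {A : Set} c (p : A → Bool) xs → countB (λ x → c ∧ p x) xs ≡ (if c then countB p xs else 0)
countB-∧ true  p xs       = refl
countB-∧ false p []       = refl
countB-∧ false p (x ∷ xs) = countB-∧ false p xs

countB-false : ∀ {A : Set} (xs : List A) → countB (λ _ → false) xs ≡ 0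
countB-false []       = refl
countB-false (_ ∷ xs) = countB-false xs

-- Counting the partitions of 𝒮

δ₀ : ℤ → ℤ → ℤ
δ₀ (+ zero) (+ zero) = 1ℤ
δ₀ _        _        = 0ℤ

-- count r b m n k is the number of partitions in 𝒮 with m parts, all of them
-- in [r, b], weight n and k even parts.
mutual
  count : ℕ → ℕ → ℕ → ℤ → ℤ → ℤ
  count r b zero    n k = δ₀ n k
  count r b (suc m) n k = sumTo b (countLargest r m n k)

  countLargest : ℕ → ℕ → ℤ → ℤ → ℕ → ℤ
  countLargest r m n k h =
    if r ≤ᵇ h then count r (h ∸ gap h) m (n - + h) (k - + evenBit h) else 0ℤ

countᶻ : ℕ → ℕ → ℤ → ℤ → ℤ → ℤ
countᶻ r b (+ m)    n k = count r b m n k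
countᶻ r b -[1+ _ ] n k = 0ℤ

-- F r M n k is the coefficient of x^M y^k q^n in the generating function of
-- the partitions in 𝒮 with all parts ≥ r; it vanishes if M, n or k is negative.
F : ℕ → ℤ → ℤ → ℤ → ℤ
F r M n k = countᶻ r ∣ n ∣ M n k

count-weight<0 : ∀ r b m {n} k → n < 0ℤ → count r b m n k ≡ 0ℤ
count-weight<0 r b zero    k -<+ = refl
count-weight<0 r b (suc m) k n<0 = sumTo-zero b λ {h} _ _ →
  if-then-0 (r ≤ᵇ h) (count-weight<0 r (h ∸ gap h) m _ (i<0⇒i-n<0 h n<0))

count-evens<0 : ∀ r b m n {k} → k < 0ℤ → count r b m n k ≡ 0ℤ
count-evens<0 r b zero    (+ zero)  -<+ = refl
count-evens<0 r b zero    (+ suc _) -<+ = refl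
count-evens<0 r b zero    -[1+ _ ]  -<+ = refl
count-evens<0 r b (suc m) n k<0 = sumTo-zero b λ {h} _ _ →
  if-then-0 (r ≤ᵇ h) (count-evens<0 r (h ∸ gap h) m _ (i<0⇒i-n<0 (evenBit h) k<0))

countᶻ-weight<0 : ∀ r b M {n} k → n < 0ℤ → countᶻ r b M n k ≡ 0ℤ
countᶻ-weight<0 r b (+ m)    k n<0 = count-weight<0 r b m k n<0
countᶻ-weight<0 r b -[1+ _ ] k n<0 = refl

countᶻ-evens<0 : ∀ r b M n {k} → k < 0ℤ → countᶻ r b M n k ≡ 0ℤ
countᶻ-evens<0 r b (+ m)    n k<0 = count-evens<0 r b m n k<0
countᶻ-evens<0 r b -[1+ _ ] n k<0 = refl

F-weight<0 : ∀ r M {n} k → n < 0ℤ → F r M n k ≡ 0ℤ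
F-weight<0 r M {n} = countᶻ-weight<0 r ∣ n ∣ M

F-evens<0 : ∀ r M n {k} → k < 0ℤ → F r M n k ≡ 0ℤ
F-evens<0 r M n = countᶻ-evens<0 r ∣ n ∣ M n

countLargestᶻ : ℕ → ℕ → ℤ → ℤ → ℤ → ℤ
countLargestᶻ r h M n k =
  if r ≤ᵇ h then countᶻ r (h ∸ gap h) (M - 1ℤ) (n - + h) (k - + evenBit h) else 0ℤ

countᶻ-suc : ∀ r b M n k → countᶻ r (suc b) M n k ≡ countᶻ r b M n k + countLargestᶻ r (suc b) M n k
countᶻ-suc r b (+ zero)  n k = sym (trans (cong (_+_ (δ₀ n k)) (if-eta (r ≤ᵇ suc b))) (ℤₚ.+-identityʳ _))
countᶻ-suc r b (+ suc m) n k = refl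
countᶻ-suc r b -[1+ _ ]  n k = sym (cong (_+_ 0ℤ) (if-eta (r ≤ᵇ suc b)))

count-<bound : ∀ r b m n k → b ℕ.< r → count r b m n k ≡ count r 0 m n k
count-<bound r b zero    n k b<r = refl
count-<bound r b (suc m) n k b<r = sumTo-zero b λ {h} _ h≤b →
  if-> (ℕₚ.≤-<-trans h≤b b<r)

countᶻ-<bound : ∀ r b M n k → b ℕ.< r → countᶻ r b M n k ≡ countᶻ r 0 M n k
countᶻ-<bound r b (+ m)    n k = count-<bound r b m n k
countᶻ-<bound r b -[1+ _ ] n k _ = refl

countᶻ-bound0 : ∀ r s M n k → countᶻ r 0 M n k ≡ countᶻ s 0 M n k
countᶻ-bound0 r s (+ zero)  n k = refl
countᶻ-bound0 r s (+ suc m) n k = refl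
countᶻ-bound0 r s -[1+ _ ]  n k = refl

countᶻ-stable : ∀ r b M n k → ∣ n ∣ ℕ.≤ b → countᶻ r b M n k ≡ F r M n k
countᶻ-stable r zero    M (+ _)    k z≤n = refl
countᶻ-stable r (suc b) M (+ n)    k n≤b+1 with ℕₚ.m≤n⇒m<n∨m≡n n≤b+1
... | inj₂ refl      = refl
... | inj₁ (s≤s n≤b) = begin
  countᶻ r (suc b) M (+ n) k                             ≡⟨ countᶻ-suc r b M (+ n) k ⟩
  countᶻ r b M (+ n) k + countLargestᶻ r (suc b) M (+ n) k
    ≡⟨ cong (_+_ (countᶻ r b M (+ n) k)) (if-then-0 (r ≤ᵇ suc b) (countᶻ-weight<0 r _ (M - 1ℤ) _ (m<n⇒+m-+n<0 (s≤s n≤b)))) ⟩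
  countᶻ r b M (+ n) k + 0ℤ                              ≡⟨ ℤₚ.+-identityʳ _ ⟩
  countᶻ r b M (+ n) k                                   ≡⟨ countᶻ-stable r b M (+ n) k n≤b ⟩
  F r M (+ n) k                                          ∎
  where open ≡-Reasoning
countᶻ-stable r b M -[1+ j ] k _ = trans (countᶻ-weight<0 r b M k -<+) (sym (F-weight<0 r M k -<+))

-- The functional equations

∸-gap< : ∀ b → suc b ∸ gap (suc b) ℕ.< suc b
∸-gap< b = s≤s (ℕₚ.∸-monoʳ-≤ (suc b) (ℕₚ.≤-trans (s≤s z≤n) (gap≥3 (suc b))))

countSmallestᶻ : ℕ → ℕ → ℤ → ℤ → ℤ → ℤ
countSmallestᶻ r b M n k =
  if r ≤ᵇ b then countᶻ (r ℕ.+ gap r) b (M - 1ℤ) (n - + r) (k - + evenBit r) else 0ℤ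

module _ {r : ℕ} (r>0 : 0 ℕ.< r) where

  private
    r⁺ : ℕ
    r⁺ = r ℕ.+ gap r

    Split : ℕ → Set
    Split b = ∀ M n k → countᶻ r b M n k ≡ countᶻ (suc r) b M n k + countSmallestᶻ r b M n k

    split-zero : Split 0
    split-zero M n k = begin
      countᶻ r 0 M n k                                    ≡⟨ countᶻ-bound0 r (suc r) M n k ⟩
      countᶻ (suc r) 0 M n k                              ≡⟨ sym (ℤₚ.+-identityʳ _) ⟩
      countᶻ (suc r) 0 M n k + 0ℤ                         ≡⟨ cong (_+_ (countᶻ (suc r) 0 M n k)) (sym (if-> r>0)) ⟩
      countᶻ (suc r) 0 M n k + countSmallestᶻ r 0 M n k   ∎
      where open ≡-Reasoning

    split-< : ∀ {b} → r ℕ.≤ b → Split b → Split (suc b ∸ gap (suc b)) → Split (suc b)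
    split-< {b} r≤b ih ih′ M n k = begin
        countᶻ r x M n k
      ≡⟨ countᶻ-suc r b M n k ⟩
        countᶻ r b M n k + countLargestᶻ r x M n k
      ≡⟨ cong₂ _+_ (ih M n k) (if-≤ r≤x) ⟩
        (A + countSmallestᶻ r b M n k) + countᶻ r x′ M′ n′ k′
      ≡⟨ cong₂ (λ u v → (A + u) + v) (if-≤ r≤b) (ih′ M′ n′ k′) ⟩
        (A + X) + (C + countSmallestᶻ r x′ M′ n′ k′)
      ≡⟨ cong (λ u → (A + X) + (C + u)) smallest-after-largest ⟩
        (A + X) + (C + D)
      ≡⟨ interchange A X C D ⟩
        (A + C) + (X + D)
      ≡⟨ cong₂ _+_ (sym A+C) (sym X+D) ⟩
        countᶻ (suc r) x M n k + countSmallestᶻ r x M n k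
      ∎
      where
      open ≡-Reasoning
      x = suc b
      x′ = x ∸ gap x
      M′ = M - 1ℤ
      n′ = n - + x
      k′ = k - + evenBit x
      r≤x = ℕₚ.m≤n⇒m≤1+n r≤b
      A = countᶻ (suc r) b M n k
      X = countᶻ r⁺ b M′ (n - + r) (k - + evenBit r)
      C = countᶻ (suc r) x′ M′ n′ k′
      D = countLargestᶻ r⁺ x M′ (n - + r) (k - + evenBit r)
      A+C : countᶻ (suc r) x M n k ≡ A + C
      A+C = trans (countᶻ-suc (suc r) b M n k) (cong (_+_ A) (if-≤ (s≤s r≤b)))
      X+D : countSmallestᶻ r x M n k ≡ X + D
      X+D = trans (if-≤ r≤x) (countᶻ-suc r⁺ b M′ (n - + r) (k - + evenBit r))
      smallest-after-largest : countSmallestᶻ r x′ M′ n′ k′ ≡ D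
      smallest-after-largest =
        cong₂ (λ c v → if c then v else 0ℤ) (≤ᵇ-gap-sym x r>0)
              (cong₂ (countᶻ r⁺ x′ (M′ - 1ℤ)) (xy∙z≈xz∙y n _ _) (xy∙z≈xz∙y k _ _))

    split-≡ : ∀ {b} → suc b ≡ r → Split b → Split (suc b)
    split-≡ {b} x≡r ih M n k = begin
        countᶻ r x M n k
      ≡⟨ countᶻ-suc r b M n k ⟩
        countᶻ r b M n k + countLargestᶻ r x M n k
      ≡⟨ cong₂ _+_ (ih M n k) (if-≤ r≤x) ⟩
        (A + countSmallestᶻ r b M n k) + countᶻ r (x ∸ gap x) M′ (n - + x) (k - + evenBit x)
      ≡⟨ cong₂ (λ u v → (A + u) + v) (if-> b<r) only-part ⟩
        (A + 0ℤ) + countSmallestᶻ r x M n k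
      ≡⟨ cong (λ u → (A + u) + countSmallestᶻ r x M n k) (sym (if-> x<r+1)) ⟩
        (A + countLargestᶻ (suc r) x M n k) + countSmallestᶻ r x M n k
      ≡⟨ cong (λ u → u + countSmallestᶻ r x M n k) (sym (countᶻ-suc (suc r) b M n k)) ⟩
        countᶻ (suc r) x M n k + countSmallestᶻ r x M n k
      ∎
      where
      open ≡-Reasoning
      x = suc b
      M′ = M - 1ℤ
      A = countᶻ (suc r) b M n k
      b<r : b ℕ.< r
      b<r = ℕₚ.≤-reflexive x≡r
      r≤x : r ℕ.≤ x
      r≤x = ℕₚ.≤-reflexive (sym x≡r)
      x<r+1 : x ℕ.< suc r
      x<r+1 = s≤s (ℕₚ.≤-reflexive x≡r)
      only-part : countᶻ r (x ∸ gap x) M′ (n - + x) (k - + evenBit x) ≡ countSmallestᶻ r x M n k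
      only-part = begin
        countᶻ r (x ∸ gap x) M′ (n - + x) (k - + evenBit x) ≡⟨ countᶻ-<bound r _ M′ _ _ (subst (_ ℕ.<_) x≡r (∸-gap< b)) ⟩
        countᶻ r 0 M′ (n - + x) (k - + evenBit x)           ≡⟨ countᶻ-bound0 r r⁺ M′ _ _ ⟩
        countᶻ r⁺ 0 M′ (n - + x) (k - + evenBit x)          ≡⟨ cong (λ y → countᶻ r⁺ 0 M′ (n - + y) (k - + evenBit y)) x≡r ⟩
        countᶻ r⁺ 0 M′ (n - + r) (k - + evenBit r)          ≡⟨ sym (countᶻ-<bound r⁺ x M′ _ _ x<r⁺) ⟩
        countᶻ r⁺ x M′ (n - + r) (k - + evenBit r)          ≡⟨ sym (if-≤ r≤x) ⟩
        countSmallestᶻ r x M n k                            ∎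
        where
        x<r⁺ : x ℕ.< r⁺
        x<r⁺ = subst (ℕ._< r⁺) (sym x≡r) (ℕₚ.m<m+n r (ℕₚ.<-≤-trans (s≤s z≤n) (gap≥3 r)))

    split-> : ∀ {b} → suc b ℕ.< r → Split b → Split (suc b)
    split-> {b} x<r ih M n k = begin
        countᶻ r x M n k
      ≡⟨ countᶻ-suc r b M n k ⟩
        countᶻ r b M n k + countLargestᶻ r x M n k
      ≡⟨ cong₂ _+_ (ih M n k) (if-> x<r) ⟩
        (A + countSmallestᶻ r b M n k) + 0ℤ
      ≡⟨ cong (λ u → (A + u) + 0ℤ) (if-> (ℕₚ.<-trans (ℕₚ.n<1+n b) x<r)) ⟩
        (A + 0ℤ) + 0ℤ
      ≡⟨ cong₂ (λ u v → (A + u) + v) (sym (if-> (ℕₚ.m<n⇒m<1+n x<r))) (sym (if-> x<r)) ⟩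
        (A + countLargestᶻ (suc r) x M n k) + countSmallestᶻ r x M n k
      ≡⟨ cong (λ u → u + countSmallestᶻ r x M n k) (sym (countᶻ-suc (suc r) b M n k)) ⟩
        countᶻ (suc r) x M n k + countSmallestᶻ r x M n k
      ∎
      where
      open ≡-Reasoning
      x = suc b
      A = countᶻ (suc r) b M n k

    split : ∀ b → Split b
    split = <-rec Split step
      where
      step : ∀ b → (∀ {b′} → b′ ℕ.< b → Split b′) → Split b
      step zero    _   = split-zero
      step (suc b) rec with ℕₚ.<-cmp r (suc b)
      ... | tri< r<x _ _ = split-< (ℕ.s≤s⁻¹ r<x) (rec ℕₚ.≤-refl) (rec (∸-gap< b))
      ... | tri≈ _ r≡x _ = split-≡ (sym r≡x) (rec ℕₚ.≤-refl)
      ... | tri> _ _ x<r = split-> x<r (rec ℕₚ.≤-refl)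

  F-smallest : ∀ M n k → F r M n k ≡ F (suc r) M n k + F (r ℕ.+ gap r) (M - 1ℤ) (n - + r) (k - + evenBit r)
  F-smallest M n k = begin
      F r M n k
    ≡⟨ sym (countᶻ-stable r b M n k (ℕₚ.m≤m+n ∣ n ∣ r)) ⟩
      countᶻ r b M n k
    ≡⟨ split b M n k ⟩
      countᶻ (suc r) b M n k + countSmallestᶻ r b M n k
    ≡⟨ cong₂ _+_ (countᶻ-stable (suc r) b M n k (ℕₚ.m≤m+n ∣ n ∣ r)) (if-≤ (ℕₚ.m≤n+m r ∣ n ∣)) ⟩
      F (suc r) M n k + countᶻ r⁺ b (M - 1ℤ) (n - + r) (k - + evenBit r)
    ≡⟨ cong (_+_ (F (suc r) M n k)) (countᶻ-stable r⁺ b (M - 1ℤ) (n - + r) (k - + evenBit r) (ℤₚ.∣i-j∣≤∣i∣+∣j∣ n (+ r))) ⟩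
      F (suc r) M n k + F r⁺ (M - 1ℤ) (n - + r) (k - + evenBit r)
    ∎
    where
    open ≡-Reasoning
    b : ℕ
    b = ∣ n ∣ ℕ.+ r

count-+6-bound : ∀ r h m n k → count (6 ℕ.+ suc r) ((h ℕ.+ 6) ∸ gap h) m n k ≡ count (6 ℕ.+ suc r) ((h ∸ gap h) ℕ.+ 6) m n k
count-+6-bound r h m n k with ℕₚ.≤-total (gap h) h
... | inj₁ g≤h = cong (λ b → count (6 ℕ.+ suc r) b m n k) (ℕₚ.+-∸-comm 6 g≤h)
... | inj₂ h≤g = trans (count-<bound _ _ m n k (ℕₚ.≤-<-trans lhs≤6 6<r₆)) (sym (count-<bound _ _ m n k rhs<r₆))
  where
  6<r₆ : 6 ℕ.< 6 ℕ.+ suc r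
  6<r₆ = ℕₚ.m<m+n 6 (s≤s z≤n)
  lhs≤6 : (h ℕ.+ 6) ∸ gap h ℕ.≤ 6
  lhs≤6 = subst ((h ℕ.+ 6) ∸ gap h ℕ.≤_) (ℕₚ.m+n∸m≡n (gap h) 6) (ℕₚ.∸-monoˡ-≤ (gap h) (ℕₚ.+-monoˡ-≤ 6 h≤g))
  rhs<r₆ : (h ∸ gap h) ℕ.+ 6 ℕ.< 6 ℕ.+ suc r
  rhs<r₆ = subst (λ x → x ℕ.+ 6 ℕ.< 6 ℕ.+ suc r) (sym (ℕₚ.m≤n⇒m∸n≡0 h≤g)) 6<r₆

≤ᵇ-+6 : ∀ r h → (6 ℕ.+ suc r ≤ᵇ h ℕ.+ 6) ≡ (suc r ≤ᵇ h)
≤ᵇ-+6 r h rewrite ℕₚ.+-comm h 6 = refl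

weight-+6 : ∀ (n h m : ℤ) → (n - (h + + 6)) - + 6 * m ≡ (n - + 6 * (+ 1 + m)) - h
weight-+6 = solve-∀

-- Subtracting 6 from each part preserves membership in 𝒮 and the parity of
-- every part, since gap and evenBit have period 6.
count-+6 : ∀ r b m n k → count (6 ℕ.+ suc r) (b ℕ.+ 6) m n k ≡ count (suc r) b m (n - + (6 ℕ.* m)) k
count-+6 r b zero    n k = cong (λ x → δ₀ x k) (sym (ℤₚ.+-identityʳ n))
count-+6 r b (suc m) n k = begin
    sumTo (b ℕ.+ 6) (countLargest r₆ m n k)
  ≡⟨ sumTo-+ b 6 _ ⟩
    sumTo 6 (countLargest r₆ m n k) + sumTo b (λ h → countLargest r₆ m n k (h ℕ.+ 6))
  ≡⟨ cong (λ u → u + sumTo b (λ h → countLargest r₆ m n k (h ℕ.+ 6))) no-small-parts ⟩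
    0ℤ + sumTo b (λ h → countLargest r₆ m n k (h ℕ.+ 6))
  ≡⟨ ℤₚ.+-identityˡ _ ⟩
    sumTo b (λ h → countLargest r₆ m n k (h ℕ.+ 6))
  ≡⟨ sumTo-cong b (λ {h} _ _ → largest-+6 h) ⟩
    sumTo b (countLargest (suc r) m n₆ k)
  ∎
  where
  open ≡-Reasoning
  r₆ = 6 ℕ.+ suc r
  n₆ = n - + (6 ℕ.* suc m)
  no-small-parts : sumTo 6 (countLargest r₆ m n k) ≡ 0ℤ
  no-small-parts = refl
  weight : ∀ h → (n - + (h ℕ.+ 6)) - + (6 ℕ.* m) ≡ n₆ - + h
  weight h = begin
    (n - + (h ℕ.+ 6)) - + (6 ℕ.* m)   ≡⟨ cong (λ z → (n - + (h ℕ.+ 6)) - z) (ℤₚ.pos-* 6 m) ⟩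
    (n - + (h ℕ.+ 6)) - + 6 * + m     ≡⟨ weight-+6 n (+ h) (+ m) ⟩
    (n - + 6 * + suc m) - + h         ≡⟨ cong (λ z → (n - z) - + h) (sym (ℤₚ.pos-* 6 (suc m))) ⟩
    n₆ - + h                          ∎
  largest-+6 : ∀ h → countLargest r₆ m n k (h ℕ.+ 6) ≡ countLargest (suc r) m n₆ k h
  largest-+6 h = cong₂ (λ c v → if c then v else 0ℤ) (≤ᵇ-+6 r h) (begin
    count r₆ ((h ℕ.+ 6) ∸ gap (h ℕ.+ 6)) m (n - + (h ℕ.+ 6)) (k - + evenBit (h ℕ.+ 6))
      ≡⟨ cong₂ (λ g e → count r₆ ((h ℕ.+ 6) ∸ g) m (n - + (h ℕ.+ 6)) (k - + e)) (gap-+6 h) (evenBit-+6 h) ⟩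
    count r₆ ((h ℕ.+ 6) ∸ gap h) m (n - + (h ℕ.+ 6)) (k - + evenBit h)
      ≡⟨ count-+6-bound r h m _ _ ⟩
    count r₆ ((h ∸ gap h) ℕ.+ 6) m (n - + (h ℕ.+ 6)) (k - + evenBit h)
      ≡⟨ count-+6 r (h ∸ gap h) m _ _ ⟩
    count (suc r) (h ∸ gap h) m ((n - + (h ℕ.+ 6)) - + (6 ℕ.* m)) (k - + evenBit h)
      ≡⟨ cong (λ z → count (suc r) (h ∸ gap h) m z (k - + evenBit h)) (weight h) ⟩
    count (suc r) (h ∸ gap h) m (n₆ - + h) (k - + evenBit h)
      ∎)

F-+6 : ∀ r M n k → F (6 ℕ.+ suc r) M n k ≡ F (suc r) M (n - + 6 * M) k
F-+6 r -[1+ _ ] n k = refl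
F-+6 r (+ m)    n k = begin
    F (6 ℕ.+ suc r) (+ m) n k
  ≡⟨ sym (countᶻ-stable _ (c ℕ.+ 6) (+ m) n k (ℕₚ.≤-trans (ℕₚ.m≤m+n ∣ n ∣ _) (ℕₚ.m≤m+n c 6))) ⟩
    count (6 ℕ.+ suc r) (c ℕ.+ 6) m n k
  ≡⟨ count-+6 r c m n k ⟩
    count (suc r) c m (n - + (6 ℕ.* m)) k
  ≡⟨ countᶻ-stable (suc r) c (+ m) _ k (ℕₚ.m≤n+m _ ∣ n ∣) ⟩
    F (suc r) (+ m) (n - + (6 ℕ.* m)) k
  ≡⟨ cong (λ z → F (suc r) (+ m) (n - z) k) (ℤₚ.pos-* 6 m) ⟩
    F (suc r) (+ m) (n - + 6 * + m) k
  ∎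
  where
  open ≡-Reasoning
  c = ∣ n ∣ ℕ.+ ∣ n - + (6 ℕ.* m) ∣

-- Compositions and the coefficients a(M)

Composition : ℕ → List ℕ → Set
Composition n μ = sum μ ≡ n × All (0 ℕ.<_) μ

comps-sound : ∀ n → All (Composition n) (comps n)
comps-sound zero          = (refl , []) ∷ []
comps-sound (suc zero)    = (refl , s≤s z≤n ∷ []) ∷ []
comps-sound (suc (suc n)) = ++⁺ (map⁺ (All.map incHead-sound (comps-sound (suc n))))
                               (map⁺ (All.map 1∷-sound (comps-sound (suc n))))
  where
  incHead-sound : ∀ {μ} → Composition (suc n) μ → Composition (suc (suc n)) (incHead μ)
  incHead-sound {_ ∷ _} (Σμ≡n , _ ∷ parts>0) = cong suc Σμ≡n , s≤s z≤n ∷ parts>0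
  1∷-sound : ∀ {μ} → Composition (suc n) μ → Composition (suc (suc n)) (1 ∷ μ)
  1∷-sound (Σμ≡n , parts>0) = cong suc Σμ≡n , s≤s z≤n ∷ parts>0

countB-comps-suc : ∀ n (p : List ℕ → Bool) →
  + countB p (comps (suc n)) ≡ sumTo (suc n) (λ h → + countB (λ t → p (h ∷ t)) (comps (suc n ∸ h)))
countB-comps-suc zero    p = refl
countB-comps-suc (suc n) p = begin
    + countB p (map incHead C ++ map (1 ∷_) C)
  ≡⟨ cong +_ (trans (countB-++ p (map incHead C) (map (1 ∷_) C)) (cong₂ ℕ._+_ (countB-map p incHead C) (countB-map p (1 ∷_) C))) ⟩
    + (countB (p ∘ incHead) C ℕ.+ countB (λ t → p (1 ∷ t)) C)
  ≡⟨ ℤₚ.+-comm (+ countB (p ∘ incHead) C) (+ countB (λ t → p (1 ∷ t)) C) ⟩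
    + countB (λ t → p (1 ∷ t)) C + + countB (p ∘ incHead) C
  ≡⟨ cong (_+_ (+ countB (λ t → p (1 ∷ t)) C)) (countB-comps-suc n (p ∘ incHead)) ⟩
    + countB (λ t → p (1 ∷ t)) C + sumTo (suc n) (λ h → + countB (λ t → p (suc h ∷ t)) (comps (suc n ∸ h)))
  ≡⟨ sym (sumTo-suc (suc n) (λ h → + countB (λ t → p (h ∷ t)) (comps (suc (suc n) ∸ h)))) ⟩
    sumTo (suc (suc n)) (λ h → + countB (λ t → p (h ∷ t)) (comps (suc (suc n) ∸ h)))
  ∎
  where
  open ≡-Reasoning
  C = comps (suc n)

headAtMost : ℕ → List ℕ → Bool
headAtMost b []      = true
headAtMost b (h ∷ _) = h ≤ᵇ b

admissible : ℕ → ℕ → ℕ → List ℕ → Bool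
admissible b M k μ = headAtMost b μ ∧ (inS μ ∧ ((length μ ≡ᵇ M) ∧ (numEven μ ≡ᵇ k)))

gapOK-≤ᵇ : ∀ x {y} → 0 ℕ.< y → gapOK x y ≡ (y ≤ᵇ x ∸ gap x)
gapOK-≤ᵇ x y>0 with div3 x
... | true  = sym (≤ᵇ-∸ 4 y>0)
... | false = sym (≤ᵇ-∸ 3 y>0)

inS-cons : ∀ h {t} → All (0 ℕ.<_) t → inS (h ∷ t) ≡ headAtMost (h ∸ gap h) t ∧ inS t
inS-cons h []                     = refl
inS-cons h {y ∷ ys} (y>0 ∷ _) = cong (_∧ inS (y ∷ ys)) (gapOK-≤ᵇ h y>0)

numEven-cons : ∀ h t → numEven (h ∷ t) ≡ evenBit h ℕ.+ numEven t
numEven-cons h t with even? h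
... | true  = refl
... | false = refl

≡ᵇ-+ : ∀ e x k → (e ℕ.+ x ≡ᵇ k) ≡ (e ≤ᵇ k) ∧ (x ≡ᵇ k ∸ e)
≡ᵇ-+ zero    x k       = refl
≡ᵇ-+ (suc e) x zero    = refl
≡ᵇ-+ (suc e) x (suc k) = trans (≡ᵇ-+ e x k) (cong (_∧ (x ≡ᵇ k ∸ e)) (suc≤ᵇsuc e))
  where
  suc≤ᵇsuc : ∀ e → (e ≤ᵇ k) ≡ (suc e ≤ᵇ suc k)
  suc≤ᵇsuc zero    = refl
  suc≤ᵇsuc (suc e) = refl

∧-pull : ∀ a i l e n → (a ∧ i) ∧ (l ∧ (e ∧ n)) ≡ e ∧ (a ∧ (i ∧ (l ∧ n)))
∧-pull a i l true  n = ∧-assoc a i (l ∧ n)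
∧-pull a i l false n = trans (cong ((a ∧ i) ∧_) (∧-zeroʳ l)) (∧-zeroʳ (a ∧ i))

admissible-cons : ∀ b M k h {t} → All (0 ℕ.<_) t →
  admissible b (suc M) k (h ∷ t) ≡ (h ≤ᵇ b) ∧ ((evenBit h ≤ᵇ k) ∧ admissible (h ∸ gap h) M (k ∸ evenBit h) t)
admissible-cons b M k h {t} t>0
  rewrite inS-cons h t>0 | numEven-cons h t | ≡ᵇ-+ (evenBit h) (numEven t) k =
  cong ((h ≤ᵇ b) ∧_) (∧-pull (headAtMost (h ∸ gap h) t) (inS t) (length t ≡ᵇ M) (evenBit h ≤ᵇ k) (numEven t ≡ᵇ k ∸ evenBit h))

countB-first-part : ∀ b M k h {m ts} → All (Composition m) ts →
  + countB (λ t → admissible b (suc M) k (h ∷ t)) ts ≡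
  (if h ≤ᵇ b then (if evenBit h ≤ᵇ k then + countB (admissible (h ∸ gap h) M (k ∸ evenBit h)) ts else 0ℤ) else 0ℤ)
countB-first-part b M k h {ts = ts} compositions = begin
    + countB (λ t → admissible b (suc M) k (h ∷ t)) ts
  ≡⟨ cong +_ (countB-cong (λ c → admissible-cons b M k h (proj₂ c)) compositions) ⟩
    + countB (λ t → (h ≤ᵇ b) ∧ ((e ≤ᵇ k) ∧ admissible b′ M (k ∸ e) t)) ts
  ≡⟨ cong +_ (trans (countB-∧ (h ≤ᵇ b) _ ts) (cong (λ v → if h ≤ᵇ b then v else 0) (countB-∧ (e ≤ᵇ k) _ ts))) ⟩
    + (if h ≤ᵇ b then (if e ≤ᵇ k then countB (admissible b′ M (k ∸ e)) ts else 0) else 0)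
  ≡⟨ if-float +_ (h ≤ᵇ b) ⟩
    (if h ≤ᵇ b then + (if e ≤ᵇ k then countB (admissible b′ M (k ∸ e)) ts else 0) else 0ℤ)
  ≡⟨ cong (λ v → if h ≤ᵇ b then v else 0ℤ) (if-float +_ (e ≤ᵇ k)) ⟩
    (if h ≤ᵇ b then (if e ≤ᵇ k then + countB (admissible b′ M (k ∸ e)) ts else 0ℤ) else 0ℤ)
  ∎
  where
  open ≡-Reasoning
  e = evenBit h
  b′ = h ∸ gap h

count-comps : ∀ M b n k → + countB (admissible b M k) (comps n) ≡ count 1 b M (+ n) (+ k)
count-comps zero    b zero    zero    = refl
count-comps zero    b zero    (suc k) = refl
count-comps zero    b (suc n) k       =
  cong +_ (trans (countB-cong no-parts (comps-sound (suc n))) (countB-false (comps (suc n))))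
  where
  no-parts : ∀ {μ} → Composition (suc n) μ → admissible b 0 k μ ≡ false
  no-parts {x ∷ xs} _ = trans (cong ((x ≤ᵇ b) ∧_) (∧-zeroʳ (inS (x ∷ xs)))) (∧-zeroʳ (x ≤ᵇ b))
count-comps (suc M) b zero    k =
  sym (sumTo-zero b λ {h} h>0 _ → if-then-0 (1 ≤ᵇ h) (count-weight<0 1 _ M _ (m<n⇒+m-+n<0 h>0)))
count-comps (suc M) b (suc n) k = begin
    + countB (admissible b (suc M) k) (comps (suc n))
  ≡⟨ countB-comps-suc n (admissible b (suc M) k) ⟩
    sumTo (suc n) (λ h → + countB (λ t → admissible b (suc M) k (h ∷ t)) (comps (suc n ∸ h)))
  ≡⟨ sumTo-cong (suc n) first-part ⟩
    sumTo (suc n) (λ h → if h ≤ᵇ b then countLargest 1 M (+ suc n) (+ k) h else 0ℤ)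
  ≡⟨ sym (sumTo-truncate b (suc n) _ λ {h} n<h → if-then-0 (1 ≤ᵇ h) (count-weight<0 1 _ M _ (m<n⇒+m-+n<0 n<h))) ⟩
    sumTo b (countLargest 1 M (+ suc n) (+ k))
  ∎
  where
  open ≡-Reasoning
  first-part : ∀ {h} → 0 ℕ.< h → h ℕ.≤ suc n →
    + countB (λ t → admissible b (suc M) k (h ∷ t)) (comps (suc n ∸ h)) ≡ (if h ≤ᵇ b then countLargest 1 M (+ suc n) (+ k) h else 0ℤ)
  first-part {h} h>0 h≤n+1 =
    trans (countB-first-part b M k h (comps-sound (suc n ∸ h))) (cong (λ v → if h ≤ᵇ b then v else 0ℤ) remaining-parts)
    where
    tails = comps (suc n ∸ h)
    e = evenBit h
    b′ = h ∸ gap h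
    remaining-parts : (if e ≤ᵇ k then + countB (admissible b′ M (k ∸ e)) tails else 0ℤ) ≡ countLargest 1 M (+ suc n) (+ k) h
    remaining-parts with e ℕ.≤? k
    ... | yes e≤k = begin
      (if e ≤ᵇ k then + countB (admissible b′ M (k ∸ e)) tails else 0ℤ) ≡⟨ if-≤ e≤k ⟩
      + countB (admissible b′ M (k ∸ e)) tails                         ≡⟨ count-comps M b′ (suc n ∸ h) (k ∸ e) ⟩
      count 1 b′ M (+ (suc n ∸ h)) (+ (k ∸ e))                     ≡⟨ cong₂ (count 1 b′ M) (sym (+m-+n≡+[m∸n] h≤n+1)) (sym (+m-+n≡+[m∸n] e≤k)) ⟩
      count 1 b′ M (+ suc n - + h) (+ k - + e)                      ≡⟨ sym (if-≤ h>0) ⟩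
      countLargest 1 M (+ suc n) (+ k) h                            ∎
    ... | no e≰k = trans (if-> k<e) (sym (trans (if-≤ h>0) (count-evens<0 1 b′ M _ (m<n⇒+m-+n<0 k<e))))
      where
      k<e : k ℕ.< e
      k<e = ℕₚ.≰⇒> e≰k

a≡F₁ : ∀ M n k → a M n k ≡ F 1 (+ M) (+ n) (+ k)
a≡F₁ M n k = trans (cong +_ (countB-cong largest≤n (comps-sound n))) (count-comps M n n k)
  where
  largest≤n : ∀ {μ} → Composition n μ → (inS μ ∧ ((length μ ≡ᵇ M) ∧ (numEven μ ≡ᵇ k))) ≡ admissible n M k μ
  largest≤n {[]}     _          = refl
  largest≤n {x ∷ xs} (Σμ≡n , _) = sym (cong (_∧ _) (≤ᵇ-true (subst (x ℕ.≤_) Σμ≡n (ℕₚ.m≤m+n x (sum xs)))))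

-- Linear combinations of values of F

module LinearCombination {A : Set} (_≟_ : DecidableEquality A) where

  LC : Set
  LC = List (ℤ × A)

  ⟦_⟧ : LC → (A → ℤ) → ℤ
  ⟦ []          ⟧ ρ = 0ℤ
  ⟦ (c , x) ∷ L ⟧ ρ = c * ρ x + ⟦ L ⟧ ρ

  ⟦⟧-++ : ∀ L L′ ρ → ⟦ L ++ L′ ⟧ ρ ≡ ⟦ L ⟧ ρ + ⟦ L′ ⟧ ρ
  ⟦⟧-++ []            L′ ρ = sym (ℤₚ.+-identityˡ _)
  ⟦⟧-++ ((c , x) ∷ L) L′ ρ = trans (cong (_+_ (c * ρ x)) (⟦⟧-++ L L′ ρ)) (sym (ℤₚ.+-assoc (c * ρ x) _ _))

  ⟦⟧-cong : ∀ L {ρ σ : A → ℤ} → (∀ x → ρ x ≡ σ x) → ⟦ L ⟧ ρ ≡ ⟦ L ⟧ σ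
  ⟦⟧-cong []            ρ≗σ = refl
  ⟦⟧-cong ((c , x) ∷ L) ρ≗σ = cong₂ (λ u v → c * u + v) (ρ≗σ x) (⟦⟧-cong L ρ≗σ)

  ⟦⟧-rename : ∀ (f : A → A) L ρ → ⟦ map (map₂ f) L ⟧ ρ ≡ ⟦ L ⟧ (ρ ∘ f)
  ⟦⟧-rename f []            ρ = refl
  ⟦⟧-rename f ((c , x) ∷ L) ρ = cong (_+_ (c * ρ (f x))) (⟦⟧-rename f L ρ)

  scale : ℤ → LC → LC
  scale d = map (map₁ (d *_))

  ⟦⟧-scale : ∀ d L ρ → ⟦ scale d L ⟧ ρ ≡ d * ⟦ L ⟧ ρ
  ⟦⟧-scale d []            ρ = sym (ℤₚ.*-zeroʳ d)
  ⟦⟧-scale d ((c , x) ∷ L) ρ = begin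
    d * c * ρ x + ⟦ scale d L ⟧ ρ    ≡⟨ cong₂ _+_ (ℤₚ.*-assoc d c (ρ x)) (⟦⟧-scale d L ρ) ⟩
    d * (c * ρ x) + d * ⟦ L ⟧ ρ      ≡⟨ sym (ℤₚ.*-distribˡ-+ d _ _) ⟩
    d * (c * ρ x + ⟦ L ⟧ ρ)          ∎
    where open ≡-Reasoning

  insert : ℤ × A → LC → LC
  insert t             []              = t ∷ []
  insert (c , x) ((c′ , y) ∷ L) with x ≟ y
  ... | yes _ = (c + c′ , y) ∷ L
  ... | no  _ = (c′ , y) ∷ insert (c , x) L

  ⟦⟧-insert : ∀ t L ρ → ⟦ insert t L ⟧ ρ ≡ ⟦ t ∷ L ⟧ ρ
  ⟦⟧-insert t              []              ρ = refl
  ⟦⟧-insert (c , x) ((c′ , y) ∷ L) ρ with x ≟ y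
  ... | yes refl = begin
    (c + c′) * ρ x + ⟦ L ⟧ ρ          ≡⟨ cong (_+ ⟦ L ⟧ ρ) (ℤₚ.*-distribʳ-+ (ρ x) c c′) ⟩
    (c * ρ x + c′ * ρ x) + ⟦ L ⟧ ρ    ≡⟨ ℤₚ.+-assoc (c * ρ x) _ _ ⟩
    c * ρ x + (c′ * ρ x + ⟦ L ⟧ ρ)    ∎
    where open ≡-Reasoning
  ... | no  _ = begin
    c′ * ρ y + ⟦ insert (c , x) L ⟧ ρ  ≡⟨ cong (_+_ (c′ * ρ y)) (⟦⟧-insert (c , x) L ρ) ⟩
    c′ * ρ y + (c * ρ x + ⟦ L ⟧ ρ)     ≡⟨ x∙yz≈y∙xz (c′ * ρ y) (c * ρ x) _ ⟩
    c * ρ x + (c′ * ρ y + ⟦ L ⟧ ρ)     ∎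
    where open ≡-Reasoning

  normalise : LC → LC
  normalise = foldr insert []

  ⟦⟧-normalise : ∀ L ρ → ⟦ normalise L ⟧ ρ ≡ ⟦ L ⟧ ρ
  ⟦⟧-normalise []            ρ = refl
  ⟦⟧-normalise ((c , x) ∷ L) ρ = trans (⟦⟧-insert (c , x) (normalise L) ρ) (cong (_+_ (c * ρ x)) (⟦⟧-normalise L ρ))

  ⟦⟧-concat : ∀ Ls ρ → ⟦ concat Ls ⟧ ρ ≡ foldr (λ L s → ⟦ L ⟧ ρ + s) 0ℤ Ls
  ⟦⟧-concat []       ρ = refl
  ⟦⟧-concat (L ∷ Ls) ρ = trans (⟦⟧-++ L (concat Ls) ρ) (cong (_+_ (⟦ L ⟧ ρ)) (⟦⟧-concat Ls ρ))

  Vanishes : LC → Set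
  Vanishes = All ((_≡ 0ℤ) ∘ proj₁)

  vanishes? : ∀ L → Dec (Vanishes L)
  vanishes? = All.all? (λ t → proj₁ t ℤₚ.≟ 0ℤ)

  ⟦⟧-vanishes : ∀ L ρ → Vanishes L → ⟦ L ⟧ ρ ≡ 0ℤ
  ⟦⟧-vanishes []            ρ []           = refl
  ⟦⟧-vanishes ((_ , _) ∷ L) ρ (refl ∷ L≈0) = trans (ℤₚ.+-identityˡ _) (⟦⟧-vanishes L ρ L≈0)

-- (r , c , α , β , γ) stands for F r (M + c) (n + α M + β) (k + γ)
Atom : Set
Atom = ℕ × ℤ × ℤ × ℤ × ℤ

_≟ᴬ_ : DecidableEquality Atom
_≟ᴬ_ = ≡-dec ℕₚ._≟_ (≡-dec ℤₚ._≟_ (≡-dec ℤₚ._≟_ (≡-dec ℤₚ._≟_ ℤₚ._≟_)))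

open LinearCombination _≟ᴬ_

atomAt : ℤ → ℤ → ℤ → Atom → ℤ
atomAt M n k (r , c , α , β , γ) = F r (M + c) (n + α * M + β) (k + γ)

F-cong : ∀ r {M M′ n n′ k k′} → M ≡ M′ → n ≡ n′ → k ≡ k′ → F r M n k ≡ F r M′ n′ k′
F-cong r refl refl refl = refl

-- (c , α , β , γ) stands for the point (M + c , n + α M + β , k + γ)
Shift : Set
Shift = ℤ × ℤ × ℤ × ℤ

translate : Shift → Atom → Atom
translate (c′ , α′ , β′ , γ′) (r , c , α , β , γ) = (r , c′ + c , α′ + α , β′ + β + α * c′ , γ′ + γ)

weight-translate : ∀ n M α′ β′ α β c′ → n + (α′ + α) * M + (β′ + β + α * c′) ≡ (n + α′ * M + β′) + α * (M + c′) + β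
weight-translate = solve-∀

atomAt-translate : ∀ M n k c′ α′ β′ γ′ a →
  atomAt M n k (translate (c′ , α′ , β′ , γ′) a) ≡ atomAt (M + c′) (n + α′ * M + β′) (k + γ′) a
atomAt-translate M n k c′ α′ β′ γ′ (r , c , α , β , γ) =
  F-cong r (sym (ℤₚ.+-assoc M c′ c)) (weight-translate n M α′ β′ α β c′) (sym (ℤₚ.+-assoc k γ′ γ))

-- Rewrites F (6 + s) by F-+6; one step suffices, as smallestPartEquation r with
-- r ≤ 6 involves ranks up to 6 + gap 6 = 10.
lower : Atom → Atom
lower (suc (suc (suc (suc (suc (suc (suc r)))))) , c , α , β , γ) = (suc r , c , α - + 6 , β - + 6 * c , γ)
lower a = a

weight-lower : ∀ n α M β c → n + α * M + β - + 6 * (M + c) ≡ n + (α - + 6) * M + (β - + 6 * c)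
weight-lower = solve-∀

atomAt-lower : ∀ M n k a → atomAt M n k (lower a) ≡ atomAt M n k a
atomAt-lower M n k (suc (suc (suc (suc (suc (suc (suc r)))))) , c , α , β , γ) =
  sym (trans (F-+6 r (M + c) (n + α * M + β) (k + γ)) (cong (λ z → F (suc r) (M + c) z (k + γ)) (weight-lower n α M β c)))
atomAt-lower M n k (0 , _) = refl
atomAt-lower M n k (1 , _) = refl
atomAt-lower M n k (2 , _) = refl
atomAt-lower M n k (3 , _) = refl
atomAt-lower M n k (4 , _) = refl
atomAt-lower M n k (5 , _) = refl
atomAt-lower M n k (6 , _) = refl

smallestPartEquation : ℕ → LC
smallestPartEquation r =
  (1ℤ  , (r , 0ℤ , 0ℤ , 0ℤ , 0ℤ)) ∷
  (-1ℤ , (suc r , 0ℤ , 0ℤ , 0ℤ , 0ℤ)) ∷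
  (-1ℤ , (r ℕ.+ gap r , -1ℤ , 0ℤ , - + r , - + evenBit r)) ∷ []

cancel : ∀ B C → 1ℤ * (B + C) + (-1ℤ * B + (-1ℤ * C + 0ℤ)) ≡ 0ℤ
cancel = solve-∀

⟦smallestPartEquation⟧ : ∀ {r} → 0 ℕ.< r → ∀ M n k → ⟦ smallestPartEquation r ⟧ (atomAt M n k) ≡ 0ℤ
⟦smallestPartEquation⟧ {r} r>0 M n k = begin
    ⟦ smallestPartEquation r ⟧ (atomAt M n k)
  ≡⟨ cong₂ (λ u v → 1ℤ * u + (-1ℤ * v + (-1ℤ * atomAt M n k smaller + 0ℤ))) (at-origin r) (at-origin (suc r)) ⟩
    1ℤ * F r M n k + (-1ℤ * B + (-1ℤ * atomAt M n k smaller + 0ℤ))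
  ≡⟨ cong (λ w → 1ℤ * F r M n k + (-1ℤ * B + (-1ℤ * w + 0ℤ))) (cong (λ z → F (r ℕ.+ gap r) (M - 1ℤ) (z - + r) (k - + evenBit r)) (ℤₚ.+-identityʳ n)) ⟩
    1ℤ * F r M n k + (-1ℤ * B + (-1ℤ * C + 0ℤ))
  ≡⟨ cong (λ u → 1ℤ * u + (-1ℤ * B + (-1ℤ * C + 0ℤ))) (F-smallest r>0 M n k) ⟩
    1ℤ * (B + C) + (-1ℤ * B + (-1ℤ * C + 0ℤ))
  ≡⟨ cancel B C ⟩
    0ℤ
  ∎
  where
  open ≡-Reasoning
  smaller : Atom
  smaller = (r ℕ.+ gap r , -1ℤ , 0ℤ , - + r , - + evenBit r)
  B = F (suc r) M n k
  C = F (r ℕ.+ gap r) (M - 1ℤ) (n - + r) (k - + evenBit r)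
  at-origin : ∀ s → atomAt M n k (s , 0ℤ , 0ℤ , 0ℤ , 0ℤ) ≡ F s M n k
  at-origin s = F-cong s (ℤₚ.+-identityʳ M) (trans (ℤₚ.+-identityʳ _) (ℤₚ.+-identityʳ n)) (ℤₚ.+-identityʳ k)

-- (d , r , s) stands for d times smallestPartEquation r at the point s
Instance : Set
Instance = ℤ × ℕ × Shift

rank : Instance → ℕ
rank (_ , r , _) = r

instanceLC : Instance → LC
instanceLC (d , r , s) = scale d (map (map₂ (lower ∘ translate s)) (smallestPartEquation r))

⟦instanceLC⟧ : ∀ i → 0 ℕ.< rank i → ∀ M n k → ⟦ instanceLC i ⟧ (atomAt M n k) ≡ 0ℤ
⟦instanceLC⟧ (d , r , s@(c , α , β , γ)) r>0 M n k = begin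
    ⟦ scale d (map (map₂ (lower ∘ translate s)) E) ⟧ (atomAt M n k)
  ≡⟨ ⟦⟧-scale d (map (map₂ (lower ∘ translate s)) E) (atomAt M n k) ⟩
    d * ⟦ map (map₂ (lower ∘ translate s)) E ⟧ (atomAt M n k)
  ≡⟨ cong (d *_) (⟦⟧-rename (lower ∘ translate s) E (atomAt M n k)) ⟩
    d * ⟦ E ⟧ (atomAt M n k ∘ lower ∘ translate s)
  ≡⟨ cong (d *_) (⟦⟧-cong E λ x → trans (atomAt-lower M n k (translate s x)) (atomAt-translate M n k c α β γ x)) ⟩
    d * ⟦ E ⟧ (atomAt (M + c) (n + α * M + β) (k + γ))
  ≡⟨ cong (d *_) (⟦smallestPartEquation⟧ r>0 (M + c) (n + α * M + β) (k + γ)) ⟩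
    d * 0ℤ
  ≡⟨ ℤₚ.*-zeroʳ d ⟩
    0ℤ
  ∎
  where
  open ≡-Reasoning
  E = smallestPartEquation r

combination : List Instance → LC
combination = concatMap instanceLC

⟦combination⟧ : ∀ is → All ((0 ℕ.<_) ∘ rank) is → ∀ M n k → ⟦ combination is ⟧ (atomAt M n k) ≡ 0ℤ
⟦combination⟧ []       []          M n k = refl
⟦combination⟧ (i ∷ is) (r>0 ∷ rs) M n k =
  trans (⟦⟧-++ (instanceLC i) (combination is) (atomAt M n k)) (cong₂ _+_ (⟦instanceLC⟧ i r>0 M n k) (⟦combination⟧ is rs M n k))

-- The recurrence

monoTimes-a : ∀ c i j m n k → monoTimes (c , i , j) (a m) n k ≡ c * F 1 (+ m) (+ n - + i) (+ k - + j)
monoTimes-a c i j m n k with i ℕ.≤? n | j ℕ.≤? k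
... | yes i≤n | yes j≤k rewrite ≤ᵇ-true i≤n | ≤ᵇ-true j≤k =
  cong (c *_) (trans (a≡F₁ m (n ∸ i) (k ∸ j)) (cong₂ (F 1 (+ m)) (sym (+m-+n≡+[m∸n] i≤n)) (sym (+m-+n≡+[m∸n] j≤k))))
... | no i≰n | _ rewrite ≤ᵇ-false (ℕₚ.≰⇒> i≰n) =
  sym (trans (cong (c *_) (F-weight<0 1 (+ m) _ (m<n⇒+m-+n<0 (ℕₚ.≰⇒> i≰n)))) (ℤₚ.*-zeroʳ c))
... | yes i≤n | no j≰k rewrite ≤ᵇ-true i≤n | ≤ᵇ-false (ℕₚ.≰⇒> j≰k) =
  sym (trans (cong (c *_) (F-evens<0 1 (+ m) _ (m<n⇒+m-+n<0 (ℕₚ.≰⇒> j≰k)))) (ℤₚ.*-zeroʳ c))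

-- (c , α , d , j) stands for the monomial c q^(α (M + s) + d) y^j
-- in the coefficient of a(M + s)
SymMono : Set
SymMono = ℤ × ℕ × ℕ × ℕ

instantiate : ℕ → ℕ → SymMono → Mono
instantiate s M (c , α , d , j) = (c , α ℕ.* (M ℕ.+ s) ℕ.+ d , j)

symAtom : ℕ → SymMono → ℤ × Atom
symAtom s (c , α , d , j) = (c , (1 , + s , - + α , - + (α ℕ.* s ℕ.+ d) , - + j))

weight-linear-ring : ∀ n α M s d → n - (α * (M + s) + d) ≡ n + - α * M + - (α * s + d)
weight-linear-ring = solve-∀

weight-linear : ∀ n α M s d → + n - + (α ℕ.* (M ℕ.+ s) ℕ.+ d) ≡ + n + - + α * + M + - + (α ℕ.* s ℕ.+ d)
weight-linear n α M s d = begin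
  + n - + (α ℕ.* (M ℕ.+ s) ℕ.+ d)           ≡⟨ cong (λ z → + n - (z + + d)) (ℤₚ.pos-* α (M ℕ.+ s)) ⟩
  + n - (+ α * (+ M + + s) + + d)           ≡⟨ weight-linear-ring (+ n) (+ α) (+ M) (+ s) (+ d) ⟩
  + n + - + α * + M + - (+ α * + s + + d)   ≡⟨ cong (λ z → + n + - + α * + M + - (z + + d)) (sym (ℤₚ.pos-* α s)) ⟩
  + n + - + α * + M + - + (α ℕ.* s ℕ.+ d)   ∎
  where open ≡-Reasoning

polyTimes-a : ∀ s S M {m} n k → M ℕ.+ s ≡ m →
  polyTimes (map (instantiate s M) S) (a m) n k ≡ ⟦ map (symAtom s) S ⟧ (atomAt (+ M) (+ n) (+ k))
polyTimes-a s []                  M n k refl = refl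
polyTimes-a s ((c , α , d , j) ∷ S) M n k refl =
  cong₂ _+_ (trans (monoTimes-a c (α ℕ.* (M ℕ.+ s) ℕ.+ d) j (M ℕ.+ s) n k) (cong (λ z → c * F 1 (+ M + + s) z (+ k - + j)) (weight-linear n α M s d)))
            (polyTimes-a s S M n k refl)

coeff₀ coeff₁ coeff₂ coeff₃ coeff₄ coeff₅ : List SymMono
coeff₀ = (+ 1 , 12 , 31 , 2) ∷ (+ 1 , 12 , 32 , 3) ∷ []
coeff₁ = (-1ℤ , 12 , 22 , 0) ∷ (-1ℤ , 12 , 23 , 1) ∷ (+ 1 , 12 , 30 , 2) ∷ (-1ℤ , 12 , 25 , 3) ∷ (-1ℤ , 12 , 26 , 4) ∷ []
coeff₂ = (-1ℤ , 6 , 12 , 1) ∷ (-1ℤ , 6 , 14 , 1) ∷ (-1ℤ , 6 , 13 , 2) ∷ (-1ℤ , 6 , 15 , 2) ∷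
         (-1ℤ , 12 , 21 , 0) ∷ (+ 1 , 12 , 16 , 1) ∷ (+ 1 , 12 , 17 , 2) ∷ (-1ℤ , 12 , 24 , 3) ∷ []
coeff₃ = (-1ℤ , 6 , 6 , 0) ∷ (-1ℤ , 6 , 8 , 0) ∷ (-1ℤ , 6 , 10 , 0) ∷
         (-1ℤ , 6 , 5 , 1) ∷ (- + 2 , 6 , 7 , 1) ∷ (- + 2 , 6 , 9 , 1) ∷ (- + 2 , 6 , 11 , 1) ∷ (-1ℤ , 6 , 13 , 1) ∷
         (-1ℤ , 6 , 8 , 2) ∷ (-1ℤ , 6 , 10 , 2) ∷ (-1ℤ , 6 , 12 , 2) ∷ (+ 1 , 12 , 15 , 1) ∷ []
coeff₄ = (+ 1 , 0 , 7 , 0) ∷ (+ 1 , 0 , 8 , 1) ∷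
         (-1ℤ , 6 , 1 , 0) ∷ (-1ℤ , 6 , 3 , 0) ∷ (-1ℤ , 6 , 5 , 0) ∷ (-1ℤ , 6 , 7 , 0) ∷
         (-1ℤ , 6 , 2 , 1) ∷ (-1ℤ , 6 , 4 , 1) ∷ (-1ℤ , 6 , 6 , 1) ∷ (-1ℤ , 6 , 8 , 1) ∷ []
coeff₅ = (+ 1 , 0 , 0 , 0) ∷ (-1ℤ , 6 , 0 , 0) ∷ []

P0-coeff₀ : ∀ M → P0 M ≡ map (instantiate 0 M) coeff₀
P0-coeff₀ M = cong (λ x → (+ 1 , 12 ℕ.* x ℕ.+ 31 , 2) ∷ (+ 1 , 12 ℕ.* x ℕ.+ 32 , 3) ∷ []) (sym (ℕₚ.+-identityʳ M))

P5-coeff₅ : ∀ M → P5 M ≡ map (instantiate 5 M) coeff₅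
P5-coeff₅ M = cong (λ x → (+ 1 , 0 , 0) ∷ (-1ℤ , x , 0) ∷ []) (sym (ℕₚ.+-identityʳ (6 ℕ.* (M ℕ.+ 5))))

recurrenceLC : LC
recurrenceLC = concat (map (symAtom 0) coeff₀ ∷ map (symAtom 1) coeff₁ ∷ map (symAtom 2) coeff₂ ∷
                       map (symAtom 3) coeff₃ ∷ map (symAtom 4) coeff₄ ∷ map (symAtom 5) coeff₅ ∷ [])

reassociate : ∀ (a b c d e f : ℤ) → a + b + c + d + e + f ≡ a + (b + (c + (d + (e + (f + 0ℤ)))))
reassociate = solve-∀

recurrenceRHS≡⟦recurrenceLC⟧ : ∀ M n k → recurrenceRHS M n k ≡ ⟦ recurrenceLC ⟧ (atomAt (+ M) (+ n) (+ k))
recurrenceRHS≡⟦recurrenceLC⟧ M n k = begin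
    recurrenceRHS M n k
  ≡⟨ cong₂ _+_ (cong₂ _+_ (cong₂ _+_ (cong₂ _+_ (cong₂ _+_ t₀ t₁) t₂) t₃) t₄) t₅ ⟩
    ⟦ L₀ ⟧ ρ + ⟦ L₁ ⟧ ρ + ⟦ L₂ ⟧ ρ + ⟦ L₃ ⟧ ρ + ⟦ L₄ ⟧ ρ + ⟦ L₅ ⟧ ρ
  ≡⟨ reassociate (⟦ L₀ ⟧ ρ) (⟦ L₁ ⟧ ρ) (⟦ L₂ ⟧ ρ) (⟦ L₃ ⟧ ρ) (⟦ L₄ ⟧ ρ) (⟦ L₅ ⟧ ρ) ⟩
    ⟦ L₀ ⟧ ρ + (⟦ L₁ ⟧ ρ + (⟦ L₂ ⟧ ρ + (⟦ L₃ ⟧ ρ + (⟦ L₄ ⟧ ρ + (⟦ L₅ ⟧ ρ + 0ℤ)))))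
  ≡⟨ sym (⟦⟧-concat (L₀ ∷ L₁ ∷ L₂ ∷ L₃ ∷ L₄ ∷ L₅ ∷ []) ρ) ⟩
    ⟦ recurrenceLC ⟧ ρ
  ∎
  where
  open ≡-Reasoning
  ρ : Atom → ℤ
  ρ = atomAt (+ M) (+ n) (+ k)
  L₀ L₁ L₂ L₃ L₄ L₅ : LC
  L₀ = map (symAtom 0) coeff₀
  L₁ = map (symAtom 1) coeff₁
  L₂ = map (symAtom 2) coeff₂
  L₃ = map (symAtom 3) coeff₃
  L₄ = map (symAtom 4) coeff₄
  L₅ = map (symAtom 5) coeff₅
  t₀ : polyTimes (P0 M) (a M) n k ≡ ⟦ L₀ ⟧ ρ
  t₀ = trans (cong (λ P → polyTimes P (a M) n k) (P0-coeff₀ M)) (polyTimes-a 0 coeff₀ M n k (ℕₚ.+-identityʳ M))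
  t₁ : polyTimes (P1 M) (a (M ℕ.+ 1)) n k ≡ ⟦ L₁ ⟧ ρ
  t₁ = polyTimes-a 1 coeff₁ M n k refl
  t₂ : polyTimes (P2 M) (a (M ℕ.+ 2)) n k ≡ ⟦ L₂ ⟧ ρ
  t₂ = polyTimes-a 2 coeff₂ M n k refl
  t₃ : polyTimes (P3 M) (a (M ℕ.+ 3)) n k ≡ ⟦ L₃ ⟧ ρ
  t₃ = polyTimes-a 3 coeff₃ M n k refl
  t₄ : polyTimes (P4 M) (a (M ℕ.+ 4)) n k ≡ ⟦ L₄ ⟧ ρ
  t₄ = polyTimes-a 4 coeff₄ M n k refl
  t₅ : polyTimes (P5 M) (a (M ℕ.+ 5)) n k ≡ ⟦ L₅ ⟧ ρ
  t₅ = trans (cong (λ P → polyTimes P (a (M ℕ.+ 5)) n k) (P5-coeff₅ M)) (polyTimes-a 5 coeff₅ M n k refl)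

-- the elimination of F 2, …, F 6 from smallestPartEquation 1, …, 6 at shifted points
certificate : List Instance
certificate =
  (- + 1 , 1 , + 5 , 0ℤ , 0ℤ , 0ℤ) ∷
  (- + 1 , 1 , + 4 , 0ℤ , - + 7 , 0ℤ) ∷
  (- + 1 , 1 , + 4 , 0ℤ , - + 8 , - + 1) ∷
  (- + 1 , 2 , + 5 , 0ℤ , 0ℤ , 0ℤ) ∷
  (- + 1 , 2 , + 4 , 0ℤ , - + 7 , 0ℤ) ∷
  (- + 1 , 2 , + 4 , 0ℤ , - + 8 , - + 1) ∷
  (- + 1 , 3 , + 5 , 0ℤ , 0ℤ , 0ℤ) ∷
  (- + 1 , 3 , + 4 , 0ℤ , - + 7 , 0ℤ) ∷
  (- + 1 , 3 , + 4 , 0ℤ , - + 8 , - + 1) ∷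
  (- + 1 , 4 , + 4 , 0ℤ , - + 1 , 0ℤ) ∷
  (- + 1 , 4 , + 5 , 0ℤ , 0ℤ , 0ℤ) ∷
  (- + 1 , 4 , + 3 , 0ℤ , - + 8 , 0ℤ) ∷
  (- + 1 , 4 , + 4 , 0ℤ , - + 7 , 0ℤ) ∷
  (- + 1 , 4 , + 3 , 0ℤ , - + 9 , - + 1) ∷
  (- + 1 , 4 , + 4 , 0ℤ , - + 8 , - + 1) ∷
  (- + 1 , 5 , + 4 , 0ℤ , - + 2 , - + 1) ∷
  (- + 1 , 5 , + 4 , 0ℤ , - + 1 , 0ℤ) ∷
  (- + 1 , 5 , + 5 , 0ℤ , 0ℤ , 0ℤ) ∷
  (- + 2 , 5 , + 3 , 0ℤ , - + 9 , - + 1) ∷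
  (- + 1 , 5 , + 3 , 0ℤ , - + 8 , 0ℤ) ∷
  (- + 1 , 5 , + 4 , 0ℤ , - + 7 , 0ℤ) ∷
  (- + 1 , 5 , + 3 , 0ℤ , - + 10 , - + 2) ∷
  (- + 1 , 5 , + 4 , 0ℤ , - + 8 , - + 1) ∷
  (- + 1 , 6 , + 4 , 0ℤ , - + 2 , - + 1) ∷
  (- + 1 , 6 , + 4 , 0ℤ , - + 1 , 0ℤ) ∷
  (- + 1 , 6 , + 5 , 0ℤ , 0ℤ , 0ℤ) ∷
  (- + 2 , 6 , + 3 , 0ℤ , - + 9 , - + 1) ∷
  (- + 1 , 6 , + 3 , 0ℤ , - + 8 , 0ℤ) ∷
  (- + 1 , 6 , + 4 , 0ℤ , - + 7 , 0ℤ) ∷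
  (- + 1 , 6 , + 3 , 0ℤ , - + 10 , - + 2) ∷
  (- + 1 , 6 , + 4 , 0ℤ , - + 8 , - + 1) ∷
  (+ 2 , 1 , + 3 , - + 6 , - + 25 , - + 1) ∷
  (+ 1 , 1 , + 3 , - + 6 , - + 24 , 0ℤ) ∷
  (+ 1 , 1 , + 4 , - + 6 , - + 29 , 0ℤ) ∷
  (+ 1 , 1 , + 2 , - + 6 , - + 26 , - + 1) ∷
  (+ 1 , 1 , + 2 , - + 6 , - + 27 , - + 2) ∷
  (+ 1 , 1 , + 3 , - + 6 , - + 31 , - + 1) ∷
  (+ 1 , 1 , + 3 , - + 6 , - + 26 , - + 2) ∷
  (+ 1 , 1 , + 4 , - + 6 , - + 30 , - + 1) ∷
  (+ 1 , 2 , + 3 , - + 6 , - + 26 , - + 2) ∷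
  (+ 1 , 2 , + 3 , - + 6 , - + 25 , - + 1) ∷
  (+ 1 , 2 , + 4 , - + 6 , - + 30 , - + 1) ∷
  (- + 1 , 2 , + 2 , - + 6 , - + 26 , - + 1) ∷
  (- + 1 , 2 , + 2 , - + 6 , - + 25 , 0ℤ) ∷
  (- + 1 , 2 , + 3 , - + 6 , - + 30 , 0ℤ) ∷
  (+ 1 , 3 , + 3 , - + 6 , - + 26 , - + 2) ∷
  (+ 1 , 3 , + 3 , - + 6 , - + 25 , - + 1) ∷
  (+ 1 , 3 , + 4 , - + 6 , - + 30 , - + 1) ∷
  (- + 1 , 3 , + 2 , - + 6 , - + 26 , - + 1) ∷
  (- + 1 , 3 , + 2 , - + 6 , - + 25 , 0ℤ) ∷
  (- + 1 , 3 , + 3 , - + 6 , - + 30 , 0ℤ) ∷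
  (- + 1 , 4 , + 2 , - + 6 , - + 27 , - + 2) ∷
  (+ 1 , 4 , + 1 , - + 6 , - + 27 , - + 1) ∷
  (- + 1 , 4 , + 2 , - + 6 , - + 28 , - + 3) ∷
  (- + 1 , 4 , + 3 , - + 6 , - + 32 , - + 2) ∷
  (+ 1 , 4 , + 1 , - + 6 , - + 28 , - + 2) ∷
  (+ 1 , 4 , + 2 , - + 6 , - + 32 , - + 1) ∷ []

certificate-ranks : All ((0 ℕ.<_) ∘ rank) certificate
certificate-ranks = toWitness {a? = All.all? (λ i → 0 ℕ.<? rank i) certificate} _

certificate-cancels : Vanishes (normalise (recurrenceLC ++ combination certificate))
certificate-cancels = toWitness {a? = vanishes? (normalise (recurrenceLC ++ combination certificate))} _

mainTheorem4 : (M n k : ℕ) → recurrenceRHS M n k ≡ + 0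
mainTheorem4 M n k = begin
    recurrenceRHS M n k
  ≡⟨ recurrenceRHS≡⟦recurrenceLC⟧ M n k ⟩
    ⟦ recurrenceLC ⟧ ρ
  ≡⟨ sym (ℤₚ.+-identityʳ _) ⟩
    ⟦ recurrenceLC ⟧ ρ + 0ℤ
  ≡⟨ cong (_+_ (⟦ recurrenceLC ⟧ ρ)) (sym (⟦combination⟧ certificate certificate-ranks (+ M) (+ n) (+ k))) ⟩
    ⟦ recurrenceLC ⟧ ρ + ⟦ combination certificate ⟧ ρ
  ≡⟨ sym (⟦⟧-++ recurrenceLC (combination certificate) ρ) ⟩
    ⟦ recurrenceLC ++ combination certificate ⟧ ρ
  ≡⟨ sym (⟦⟧-normalise (recurrenceLC ++ combination certificate) ρ) ⟩
    ⟦ normalise (recurrenceLC ++ combination certificate) ⟧ ρ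
  ≡⟨ ⟦⟧-vanishes _ ρ certificate-cancels ⟩
    0ℤ
  ∎
  where
  open ≡-Reasoning
  ρ : Atom → ℤ
  ρ = atomAt (+ M) (+ n) (+ k)
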